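{- Let $m\geq 3$ be an integer and $\mathbb{F}_{2^m}^*=\mathbb{F}_{2^m}\setminus\{0\}$. For each integer $k$ with $3\leq k\leq 2^m-4$, let $W_k=\{B\subseteq \mathbb{F}_{2^m}^* : |B|=k \text{ and } \sum_{x\in B}x=0\}$. Then the pair $(\mathbb{F}_{2^m}^*,W_k)$ is a $(2^m-1,k,\lambda_k)$-BIBD for some positive integer $\lambda_k$; that is, every pair of distinct elements of $\mathbb{F}_{2^m}^*$ is contained in exactly $\lambda_k$ blocks of $W_k$.
   Context: A $(v,k,\lambda)$-BIBD (balanced incomplete block design), for positive integers $v>k\geq 2$ and $\lambda$, is a pair $(X,\mathcal{B})$ where $X$ is a set of $v$ points, $\mathcal{B}$ is a collection of $k$-subsets (blocks) of $X$, and every pair of distinct points is contained in exactly $\lambda$ blocks. -}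

module Defs where

open import Data.Bool using (Bool; true; false; _xor_)
open import Data.Nat using (ℕ; zero; suc; _≤_; _<_)
open import Data.List using (List; []; _∷_; [_]; map; _++_; filter; length; foldr)
open import Data.List.Relation.Unary.All using (All)
open import Data.List.Relation.Unary.Unique.Propositional using (Unique)
open import Data.List.Membership.Propositional using (_∈_)
open import Data.Vec using (Vec; []; _∷_; replicate; zipWith)
import Data.Vec.Properties as VecP
import Data.Bool.Properties as BoolP
open import Data.Product using (_×_)
open import Relation.Nullary using (¬_; Dec; yes; no)
open import Relation.Nullary.Decidable using (_×-dec_; ¬?)
open import Relation.Binary.PropositionalEquality using (_≡_; _≢_)
open import Relation.Binary.Definitions using (DecidableEquality)
import Data.List.Membership.DecPropositional as DecMem

module _ {X : Set} (_≟_ : DecidableEquality X) where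
  open DecMem _≟_ using (_∈?_)

  pairCount : X → X → List (List X) → ℕ
  pairCount x y blocks = length (filter (λ B → (x ∈? B) ×-dec (y ∈? B)) blocks)

  record IsBIBD (points : List X) (blocks : List (List X)) (v k lam : ℕ) : Set where
    field
      k≥2          : 2 ≤ k
      k<v          : k < v
      pointsSize   : length points ≡ v
      pointsUnique : Unique points
      blocksSize   : All (λ B → length B ≡ k) blocks
      blocksUnique : All Unique blocks
      blocksInX    : All (λ B → All (_∈ points) B) blocks
      blocksDistinct : Unique blocks
      balanced     : ∀ x y → x ∈ points → y ∈ points → x ≢ y →
                     pairCount x y blocks ≡ lam

-- The additive group of F_{2^m}: vectors over F_2 of length m (coordinates
-- w.r.t. an F_2-basis), addition = coordinatewise xor.

F2^ : ℕ → Set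
F2^ m = Vec Bool m

_≟F_ : ∀ {m} → DecidableEquality (F2^ m)
_≟F_ = VecP.≡-dec BoolP._≟_

0F : ∀ {m} → F2^ m
0F {m} = replicate m false

_+F_ : ∀ {m} → F2^ m → F2^ m → F2^ m
_+F_ = zipWith _xor_

sumF : ∀ {m} → List (F2^ m) → F2^ m
sumF = foldr _+F_ 0F

allF : ∀ m → List (F2^ m)
allF zero = [ [] ]
allF (suc m) = map (false ∷_) (allF m) ++ map (true ∷_) (allF m)

nonzeroF : ∀ m → List (F2^ m)
nonzeroF m = filter (λ x → ¬? (x ≟F 0F)) (allF m)

combinations : {A : Set} → ℕ → List A → List (List A)
combinations zero xs = [ [] ]
combinations (suc k) [] = []
combinations (suc k) (x ∷ xs) = map (x ∷_) (combinations k xs) ++ combinations (suc k) xs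

W : ∀ m → ℕ → List (List (F2^ m))
W m k = filter (λ B → sumF B ≟F 0F) (combinations k (nonzeroF m))

module Submission where

open import Defs
open import Data.Nat using (ℕ; _≤_; _∸_; _^_)
open import Data.Product using (Σ; _×_)

open import Algebra.Bundles using (CommutativeRing)
open import Algebra.Structures using (IsCommutativeMonoid)
open import Data.Bool using (Bool; true; false; not; _∧_; _xor_)
open import Data.Bool.Properties
  using (not-involutive; xor-comm; xor-assoc; xor-identityˡ; xor-identityʳ; xor-same; xor-∧-commutativeRing)
open import Data.Empty using (⊥; ⊥-elim)
open import Data.List using (List; []; _∷_; map; _++_; filter; length)
open import Data.List.Properties
  using (length-++; length-map; map-∘; map-++; filter-++; filter-≐; filter-some)
  renaming (∷-injectiveʳ to List-∷-injectiveʳ)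
open import Data.List.Membership.Propositional using (_∈_; lose)
import Data.List.Membership.DecPropositional as DecMembership
open import Data.List.Membership.Propositional.Properties
  using (∈-map⁺; ∈-map⁻; ∈-++⁺ˡ; ∈-++⁺ʳ; ∈-++⁻; ∈-filter⁺; ∈-filter⁻)
open import Data.List.Membership.Propositional.Properties.WithK using (unique∧set⇒bag)
open import Data.List.Relation.Binary.BagAndSetEquality using (∼bag⇒↭)
open import Data.List.Relation.Binary.Permutation.Propositional as ↭ using (_↭_; ↭⇒↭ₛ; prep; swap)
open import Data.List.Relation.Binary.Permutation.Propositional.Properties using (↭-length; ∈-resp-↭)
import Data.List.Relation.Binary.Permutation.Setoid.Properties as Permutationₛ
open import Data.List.Relation.Unary.All as All using (All; []; _∷_)
import Data.List.Relation.Unary.All.Properties as All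
open import Data.List.Relation.Unary.AllPairs using ([]; _∷_)
open import Data.List.Relation.Unary.Any using (here; there)
open import Data.List.Relation.Unary.Unique.DecPropositional using (unique?)
open import Data.List.Relation.Unary.Unique.Propositional using (Unique)
import Data.List.Relation.Unary.Unique.Propositional.Properties as Unique
open import Data.Nat using (zero; suc; _+_; _<_; s≤s; z≤n; _≤?_)
open import Data.Nat.Properties
  using ( +-identityʳ; +-suc; +-assoc; +-comm; +-commutativeSemigroup; +-monoʳ-≤
        ; ≤-refl; ≤-reflexive; ≤-trans; ≤-<-trans; <⇒≤; ≰⇒>; m≤n+m; m≤m+n
        ; m∸n+n≡m; m+n∸n≡m; m+[n∸m]≡n; m<n⇒0<n∸m; ∸-monoˡ-≤; ^-monoʳ-≤)
open import Algebra.Properties.CommutativeSemigroup +-commutativeSemigroup using (xy∙z≈xz∙y)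
open import Algebra.Properties.CommutativeSemigroup
  (CommutativeRing.+-commutativeSemigroup xor-∧-commutativeRing) using () renaming (interchange to xor-interchange)
open import Data.Product using (∃; _,_; proj₁; proj₂)
open import Data.Sum using (_⊎_; inj₁; inj₂)
open import Data.Vec using ([]; _∷_)
open import Data.Vec.Properties using (∷-injectiveʳ)
open import Data.Vec.Relation.Binary.Pointwise.Inductive
  using (Pointwise-≡⇒≡; zipWith-comm; zipWith-assoc; zipWith-identityˡ; zipWith-identityʳ)
open import Function using (_∘_; _⇔_; mk⇔; Equivalence)
open import Level using (0ℓ)
open import Relation.Binary.Definitions using (_Respects_; DecidableEquality)
open import Relation.Binary.PropositionalEquality
open import Relation.Nullary using (yes; no)
open import Relation.Nullary.Decidable using (¬?; _×-dec_; True; toWitness)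
open import Relation.Unary using (Pred; Decidable; _≐_)
open import Relation.Unary.Properties using (_∩?_)

-- Balance: an automorphism of the group F₂ᵐ permutes F₂ᵐ \ {0} and preserves the condition Σ B = 0, so the
-- number of blocks of W_k through {x, y} equals the number through {σ x, σ y}; and elementary row operations
-- move any two distinct nonzero vectors to the first two basis vectors e₀, e₁.
--
-- Positivity: λ_k > 0 as soon as W_k has a block. Split F₂^{m+1} into the hyperplane x₀ = 0 and its coset
-- x₀ = 1: a set S in the hyperplane together with a set T of even size in the coset sums to (0, Σ S + Σ T).
-- Induction on m with this splitting gives, for 1 ≤ n ≤ 2^m − 2, n-sets of nonzero vectors with sum the last
-- basis vector; two such sets with the same sum, placed in the two halves, give zero-sum n-sets for every
-- 3 ≤ n ≤ 2^{m+1} − 4.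

-- Counting k-subsets

filter-map : ∀ {A B : Set} {P : Pred B 0ℓ} (P? : Decidable P) (f : A → B) (xs : List A) →
             filter P? (map f xs) ≡ map f (filter (P? ∘ f) xs)
filter-map P? f []       = refl
filter-map P? f (x ∷ xs) with P? (f x)
... | yes _ = cong (f x ∷_) (filter-map P? f xs)
... | no  _ = filter-map P? f xs

length-filter-map : ∀ {A B : Set} {P : Pred B 0ℓ} (P? : Decidable P) (f : A → B) (xs : List A) →
                    length (filter P? (map f xs)) ≡ length (filter (P? ∘ f) xs)
length-filter-map P? f xs = trans (cong length (filter-map P? f xs)) (length-map f (filter (P? ∘ f) xs))

combCount : ∀ {A : Set} {P : Pred (List A) 0ℓ} → Decidable P → ℕ → List A → ℕ
combCount P? k xs = length (filter P? (combinations k xs))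

module _ {A : Set} where

  unique∧set⇒↭ : {xs ys : List A} → Unique xs → Unique ys → (∀ {z} → z ∈ xs ⇔ z ∈ ys) → xs ↭ ys
  unique∧set⇒↭ uxs uys same = ∼bag⇒↭ (unique∧set⇒bag uxs uys same)

  filter-filter : ∀ {P Q : Pred A 0ℓ} (P? : Decidable P) (Q? : Decidable Q) (xs : List A) →
                  filter P? (filter Q? xs) ≡ filter (Q? ∩? P?) xs
  filter-filter P? Q? []       = refl
  filter-filter P? Q? (x ∷ xs) with Q? x
  ... | no  _ = filter-filter P? Q? xs
  ... | yes _ with P? x
  ...   | yes _ = cong (x ∷_) (filter-filter P? Q? xs)
  ...   | no  _ = filter-filter P? Q? xs

  ∈-combinations-∷⁻ : ∀ {k} {x : A} {xs B} → B ∈ combinations (suc k) (x ∷ xs) →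
                      (∃ λ B′ → B ≡ x ∷ B′ × B′ ∈ combinations k xs) ⊎ B ∈ combinations (suc k) xs
  ∈-combinations-∷⁻ {k} {x} {xs} p with ∈-++⁻ (map (x ∷_) (combinations k xs)) p
  ... | inj₁ q = let B′ , B′∈ , eq = ∈-map⁻ (x ∷_) q in inj₁ (B′ , eq , B′∈)
  ... | inj₂ q = inj₂ q

  ∈-combinations⇒length : ∀ k (xs : List A) {B} → B ∈ combinations k xs → length B ≡ k
  ∈-combinations⇒length zero    xs       (here refl) = refl
  ∈-combinations⇒length (suc k) (x ∷ xs) p with ∈-combinations-∷⁻ {k} {x} {xs} p
  ... | inj₁ (B′ , refl , q) = cong suc (∈-combinations⇒length k xs q)
  ... | inj₂ q               = ∈-combinations⇒length (suc k) xs q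

  ∈-combinations⇒⊆ : ∀ k (xs : List A) {B} → B ∈ combinations k xs → All (_∈ xs) B
  ∈-combinations⇒⊆ zero    xs       (here refl) = []
  ∈-combinations⇒⊆ (suc k) (x ∷ xs) p with ∈-combinations-∷⁻ {k} {x} {xs} p
  ... | inj₁ (B′ , refl , q) = here refl ∷ All.map there (∈-combinations⇒⊆ k xs q)
  ... | inj₂ q               = All.map there (∈-combinations⇒⊆ (suc k) xs q)

  ∈-combinations⇒Unique : ∀ k {xs : List A} {B} → Unique xs → B ∈ combinations k xs → Unique B
  ∈-combinations⇒Unique zero    _                   (here refl) = []
  ∈-combinations⇒Unique (suc k) {x ∷ xs} (x∉ ∷ uxs) p with ∈-combinations-∷⁻ {k} {x} {xs} p
  ... | inj₁ (B′ , refl , q) =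
    All.map (λ z∈xs x≡z → All.lookup x∉ (subst (_∈ xs) (sym x≡z) z∈xs) refl) (∈-combinations⇒⊆ k xs q)
    ∷ ∈-combinations⇒Unique k uxs q
  ... | inj₂ q = ∈-combinations⇒Unique (suc k) uxs q

  unique-combinations : ∀ k {xs : List A} → Unique xs → Unique (combinations k xs)
  unique-combinations zero    _                   = [] ∷ []
  unique-combinations (suc k) {[]}     _          = []
  unique-combinations (suc k) {x ∷ xs} (x∉ ∷ uxs) =
    Unique.++⁺ (Unique.map⁺ List-∷-injectiveʳ (unique-combinations k uxs)) (unique-combinations (suc k) uxs)
      disjoint
    where
    disjoint : ∀ {B} → B ∈ map (x ∷_) (combinations k xs) × B ∈ combinations (suc k) xs → ⊥
    disjoint (p , q) with ∈-map⁻ (x ∷_) p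
    ... | _ , _ , refl = All.lookup x∉ (All.lookup (∈-combinations⇒⊆ (suc k) xs q) (here refl)) refl

  combinations-map : ∀ {B : Set} (f : A → B) k (xs : List A) →
                     combinations k (map f xs) ≡ map (map f) (combinations k xs)
  combinations-map f zero    xs       = refl
  combinations-map f (suc k) []       = refl
  combinations-map f (suc k) (x ∷ xs) = begin
    map (f x ∷_) (combinations k (map f xs)) ++ combinations (suc k) (map f xs)
      ≡⟨ cong₂ _++_ (cong (map (f x ∷_)) (combinations-map f k xs)) (combinations-map f (suc k) xs) ⟩
    map (f x ∷_) (map (map f) (combinations k xs)) ++ map (map f) (combinations (suc k) xs)
      ≡⟨ cong (_++ _) (trans (sym (map-∘ (combinations k xs))) (map-∘ (combinations k xs))) ⟩
    map (map f) (map (x ∷_) (combinations k xs)) ++ map (map f) (combinations (suc k) xs)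
      ≡⟨ map-++ (map f) (map (x ∷_) (combinations k xs)) _ ⟨
    map (map f) (map (x ∷_) (combinations k xs) ++ combinations (suc k) xs)
      ∎
    where open ≡-Reasoning

  ∈-combinations-++ : ∀ (xs ys : List A) → xs ∈ combinations (length xs) (xs ++ ys)
  ∈-combinations-++ []       ys = here refl
  ∈-combinations-++ (x ∷ xs) ys = ∈-++⁺ˡ (∈-map⁺ (x ∷_) (∈-combinations-++ xs ys))

  combCount-≐ : ∀ {P Q : Pred (List A) 0ℓ} (P? : Decidable P) (Q? : Decidable Q) → P ≐ Q →
                ∀ k xs → combCount P? k xs ≡ combCount Q? k xs
  combCount-≐ P? Q? P≐Q k xs = cong length (filter-≐ P? Q? P≐Q (combinations k xs))

combCount-map : ∀ {A B : Set} {P : Pred (List B) 0ℓ} (P? : Decidable P) (f : A → B) k (xs : List A) →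
                combCount P? k (map f xs) ≡ combCount (P? ∘ map f) k xs
combCount-map P? f k xs =
  trans (cong (length ∘ filter P?) (combinations-map f k xs)) (length-filter-map P? (map f) (combinations k xs))

module _ {A : Set} where

  combCount-∷ : ∀ {P : Pred (List A) 0ℓ} (P? : Decidable P) k x xs →
                combCount P? (suc k) (x ∷ xs) ≡ combCount (P? ∘ (x ∷_)) k xs + combCount P? (suc k) xs
  combCount-∷ P? k x xs = begin
    length (filter P? (map (x ∷_) Cs ++ combinations (suc k) xs))
      ≡⟨ cong length (filter-++ P? (map (x ∷_) Cs) _) ⟩
    length (filter P? (map (x ∷_) Cs) ++ filter P? (combinations (suc k) xs))
      ≡⟨ length-++ (filter P? (map (x ∷_) Cs)) ⟩
    length (filter P? (map (x ∷_) Cs)) + combCount P? (suc k) xs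
      ≡⟨ cong (_+ combCount P? (suc k) xs) (length-filter-map P? (x ∷_) Cs) ⟩
    combCount (P? ∘ (x ∷_)) k xs + combCount P? (suc k) xs
      ∎
    where
    open ≡-Reasoning
    Cs = combinations k xs

  combCount-∷∷ : ∀ {P : Pred (List A) 0ℓ} (P? : Decidable P) k x y xs →
                 combCount P? (suc k) (x ∷ y ∷ xs)
                 ≡ (combCount (P? ∘ (x ∷_)) k (y ∷ xs) + combCount (P? ∘ (y ∷_)) k xs) + combCount P? (suc k) xs
  combCount-∷∷ P? k x y xs = begin
    combCount P? (suc k) (x ∷ y ∷ xs)    ≡⟨ combCount-∷ P? k x (y ∷ xs) ⟩
    a + combCount P? (suc k) (y ∷ xs)    ≡⟨ cong (a +_) (combCount-∷ P? k y xs) ⟩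
    a + (b + combCount P? (suc k) xs)    ≡⟨ +-assoc a b _ ⟨
    (a + b) + combCount P? (suc k) xs    ∎
    where
    open ≡-Reasoning
    a = combCount (P? ∘ (x ∷_)) k (y ∷ xs)
    b = combCount (P? ∘ (y ∷_)) k xs

  combCount-resp-↭ : ∀ {P : Pred (List A) 0ℓ} (P? : Decidable P) → P Respects _↭_ →
                     ∀ k {xs ys} → xs ↭ ys → combCount P? k xs ≡ combCount P? k ys
  combCount-resp-↭ P? resp zero    _      = refl
  combCount-resp-↭ P? resp (suc k) ↭.refl = refl
  combCount-resp-↭ P? resp (suc k) {x ∷ xs} {.x ∷ ys} (prep x p) = begin
    combCount P? (suc k) (x ∷ xs)                           ≡⟨ combCount-∷ P? k x xs ⟩
    combCount (P? ∘ (x ∷_)) k xs + combCount P? (suc k) xs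
      ≡⟨ cong₂ _+_ (combCount-resp-↭ (P? ∘ (x ∷_)) (resp ∘ prep x) k p) (combCount-resp-↭ P? resp (suc k) p) ⟩
    combCount (P? ∘ (x ∷_)) k ys + combCount P? (suc k) ys  ≡⟨ combCount-∷ P? k x ys ⟨
    combCount P? (suc k) (x ∷ ys)                           ∎
    where open ≡-Reasoning
  combCount-resp-↭ P? resp (suc k) {x ∷ y ∷ xs} {.y ∷ .x ∷ ys} (swap x y p) = begin
    combCount P? (suc k) (x ∷ y ∷ xs)                                          ≡⟨ combCount-∷∷ P? k x y xs ⟩
    (combCount Px k (y ∷ xs) + combCount Py k xs) + combCount P? (suc k) xs
      ≡⟨ cong₂ _+_ (heads k) (combCount-resp-↭ P? resp (suc k) p) ⟩
    (combCount Py k (x ∷ ys) + combCount Px k ys) + combCount P? (suc k) ys    ≡⟨ combCount-∷∷ P? k y x ys ⟨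
    combCount P? (suc k) (y ∷ x ∷ ys)                                          ∎
    where
    open ≡-Reasoning
    Px  = P? ∘ (x ∷_)
    Py  = P? ∘ (y ∷_)
    Pxy = P? ∘ (λ B → x ∷ y ∷ B)
    Pyx = P? ∘ (λ B → y ∷ x ∷ B)
    heads : ∀ j → combCount Px j (y ∷ xs) + combCount Py j xs ≡ combCount Py j (x ∷ ys) + combCount Px j ys
    heads zero    = +-comm (combCount Px 0 xs) (combCount Py 0 xs)
    heads (suc j) = begin
      combCount Px (suc j) (y ∷ xs) + combCount Py (suc j) xs
        ≡⟨ cong (_+ combCount Py (suc j) xs) (combCount-∷ Px j y xs) ⟩
      (combCount Pxy j xs + combCount Px (suc j) xs) + combCount Py (suc j) xs
        ≡⟨ cong₂ _+_ (cong₂ _+_ Pxy≡Pyx (combCount-resp-↭ Px (resp ∘ prep x) (suc j) p))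
                     (combCount-resp-↭ Py (resp ∘ prep y) (suc j) p) ⟩
      (combCount Pyx j ys + combCount Px (suc j) ys) + combCount Py (suc j) ys
        ≡⟨ xy∙z≈xz∙y (combCount Pyx j ys) (combCount Px (suc j) ys) (combCount Py (suc j) ys) ⟩
      (combCount Pyx j ys + combCount Py (suc j) ys) + combCount Px (suc j) ys
        ≡⟨ cong (_+ combCount Px (suc j) ys) (combCount-∷ Py j x ys) ⟨
      combCount Py (suc j) (x ∷ ys) + combCount Px (suc j) ys
        ∎
      where
      Pxy≡Pyx : combCount Pxy j xs ≡ combCount Pyx j ys
      Pxy≡Pyx = trans (combCount-≐ Pxy Pyx (resp (swap x y ↭.refl) , resp (swap y x ↭.refl)) j xs)
                      (combCount-resp-↭ Pyx (resp ∘ prep y ∘ prep x) j p)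
  combCount-resp-↭ P? resp (suc k) (↭.trans p q) =
    trans (combCount-resp-↭ P? resp (suc k) p) (combCount-resp-↭ P? resp (suc k) q)

  module _ (_≟_ : DecidableEquality A) where
    open DecMembership _≟_ using (_∈?_)

    ↭-++-rest : ∀ {xs ys} → Unique xs → Unique ys → All (_∈ xs) ys →
                xs ↭ ys ++ filter (λ z → ¬? (z ∈? ys)) xs
    ↭-++-rest {xs} {ys} uxs uys ys⊆xs = unique∧set⇒↭ uxs
      (Unique.++⁺ uys (Unique.filter⁺ ∉ys? uxs) (λ (p , q) → proj₂ (∈-filter⁻ ∉ys? {xs = xs} q) p))
      (mk⇔ to from)
      where
      ∉ys? = λ z → ¬? (z ∈? ys)
      to : ∀ {z} → z ∈ xs → z ∈ ys ++ filter ∉ys? xs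
      to {z} z∈xs with z ∈? ys
      ... | yes z∈ys = ∈-++⁺ˡ z∈ys
      ... | no  z∉ys = ∈-++⁺ʳ ys (∈-filter⁺ ∉ys? z∈xs z∉ys)
      from : ∀ {z} → z ∈ ys ++ filter ∉ys? xs → z ∈ xs
      from p with ∈-++⁻ ys p
      ... | inj₁ z∈ys = All.lookup ys⊆xs z∈ys
      ... | inj₂ q    = proj₁ (∈-filter⁻ ∉ys? {xs = xs} q)

    combCount-positive : ∀ {P : Pred (List A) 0ℓ} (P? : Decidable P) → P Respects _↭_ →
                         ∀ {xs ys} → Unique xs → Unique ys → All (_∈ xs) ys → P ys →
                         1 ≤ combCount P? (length ys) xs
    combCount-positive P? resp {xs} {ys} uxs uys ys⊆xs Pys =
      subst (1 ≤_) (sym (combCount-resp-↭ P? resp (length ys) (↭-++-rest uxs uys ys⊆xs)))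
        (filter-some P? (lose (∈-combinations-++ ys _) Pys))

-- The vector space F₂ᵐ

+F-comm : ∀ {m} (x y : F2^ m) → x +F y ≡ y +F x
+F-comm x y = Pointwise-≡⇒≡ (zipWith-comm xor-comm x y)

+F-assoc : ∀ {m} (x y z : F2^ m) → (x +F y) +F z ≡ x +F (y +F z)
+F-assoc x y z = Pointwise-≡⇒≡ (zipWith-assoc xor-assoc x y z)

+F-identityˡ : ∀ {m} (x : F2^ m) → 0F +F x ≡ x
+F-identityˡ x = Pointwise-≡⇒≡ (zipWith-identityˡ xor-identityˡ x)

+F-identityʳ : ∀ {m} (x : F2^ m) → x +F 0F ≡ x
+F-identityʳ x = Pointwise-≡⇒≡ (zipWith-identityʳ xor-identityʳ x)

+F-self : ∀ {m} (x : F2^ m) → x +F x ≡ 0F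
+F-self []      = refl
+F-self (b ∷ x) = cong₂ _∷_ (xor-same b) (+F-self x)

+F-isCommutativeMonoid : ∀ {m} → IsCommutativeMonoid _≡_ (_+F_ {m}) 0F
+F-isCommutativeMonoid = record
  { isMonoid = record
    { isSemigroup = record
      { isMagma = record { isEquivalence = isEquivalence ; ∙-cong = cong₂ _+F_ }
      ; assoc   = +F-assoc
      }
    ; identity = +F-identityˡ , +F-identityʳ
    }
  ; comm = +F-comm
  }

sumF-++ : ∀ {m} (xs ys : List (F2^ m)) → sumF (xs ++ ys) ≡ sumF xs +F sumF ys
sumF-++ []       ys = sym (+F-identityˡ (sumF ys))
sumF-++ (x ∷ xs) ys = trans (cong (x +F_) (sumF-++ xs ys)) (sym (+F-assoc x (sumF xs) (sumF ys)))

sumF-resp-↭ : ∀ {m} {xs ys : List (F2^ m)} → xs ↭ ys → sumF xs ≡ sumF ys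
sumF-resp-↭ {m} p = Permutationₛ.foldr-commMonoid (setoid (F2^ m)) +F-isCommutativeMonoid (↭⇒↭ₛ p)

parity : ℕ → Bool
parity zero    = false
parity (suc n) = not (parity n)

parity-double : ∀ n → parity (n + n) ≡ false
parity-double zero    = refl
parity-double (suc n) rewrite +-suc n n = trans (not-involutive (parity (n + n))) (parity-double n)

parity-2^suc : ∀ m → parity (2 ^ suc m) ≡ false
parity-2^suc m rewrite +-identityʳ (2 ^ m) = parity-double (2 ^ m)

sumF-map-∷ : ∀ {m} b (xs : List (F2^ m)) → sumF (map (b ∷_) xs) ≡ (b ∧ parity (length xs)) ∷ sumF xs
sumF-map-∷ false []       = refl
sumF-map-∷ true  []       = refl
sumF-map-∷ false (x ∷ xs) = cong ((false ∷ x) +F_) (sumF-map-∷ false xs)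
sumF-map-∷ true  (x ∷ xs) = cong ((true ∷ x) +F_) (sumF-map-∷ true xs)

halves : ∀ {m} → List (F2^ m) → List (F2^ m) → List (F2^ (suc m))
halves xs ys = map (false ∷_) xs ++ map (true ∷_) ys

halves-unique : ∀ {m} {xs ys : List (F2^ m)} → Unique xs → Unique ys → Unique (halves xs ys)
halves-unique uxs uys = Unique.++⁺ (Unique.map⁺ ∷-injectiveʳ uxs) (Unique.map⁺ ∷-injectiveʳ uys) disjoint
  where
  disjoint : ∀ {v} → v ∈ map (false ∷_) _ × v ∈ map (true ∷_) _ → ⊥
  disjoint (p , q) with ∈-map⁻ (false ∷_) p | ∈-map⁻ (true ∷_) q
  ... | _ , _ , refl | _ , _ , ()

length-halves : ∀ {m} (xs ys : List (F2^ m)) → length (halves xs ys) ≡ length xs + length ys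
length-halves xs ys = trans (length-++ (map (false ∷_) xs)) (cong₂ _+_ (length-map _ xs) (length-map _ ys))

sumF-halves : ∀ {m} (xs ys : List (F2^ m)) → sumF (halves xs ys) ≡ parity (length ys) ∷ (sumF xs +F sumF ys)
sumF-halves xs ys = trans (sumF-++ (map (false ∷_) xs) _) (cong₂ _+F_ (sumF-map-∷ false xs) (sumF-map-∷ true ys))

∈-allF : ∀ {m} (x : F2^ m) → x ∈ allF m
∈-allF []          = here refl
∈-allF (false ∷ x) = ∈-++⁺ˡ (∈-map⁺ (false ∷_) (∈-allF x))
∈-allF (true ∷ x)  = ∈-++⁺ʳ (map (false ∷_) (allF _)) (∈-map⁺ (true ∷_) (∈-allF x))

allF-unique : ∀ m → Unique (allF m)
allF-unique zero    = [] ∷ []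
allF-unique (suc m) = halves-unique (allF-unique m) (allF-unique m)

length-allF : ∀ m → length (allF m) ≡ 2 ^ m
length-allF zero    = refl
length-allF (suc m) = trans (length-halves (allF m) (allF m))
  (cong₂ _+_ (length-allF m) (trans (length-allF m) (sym (+-identityʳ (2 ^ m)))))

sumF-allF : ∀ m → sumF (allF (suc (suc m))) ≡ 0F
sumF-allF m = trans (sumF-halves (allF (suc m)) (allF (suc m)))
  (cong₂ _∷_ (trans (cong parity (length-allF (suc m))) (parity-2^suc m)) (+F-self (sumF (allF (suc m)))))

∈-nonzeroF⁺ : ∀ {m} {x : F2^ m} → x ≢ 0F → x ∈ nonzeroF m
∈-nonzeroF⁺ {x = x} = ∈-filter⁺ (λ x → ¬? (x ≟F 0F)) (∈-allF x)

∈-nonzeroF⁻ : ∀ {m} {x : F2^ m} → x ∈ nonzeroF m → x ≢ 0F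
∈-nonzeroF⁻ {m} p = proj₂ (∈-filter⁻ (λ x → ¬? (x ≟F 0F)) {xs = allF m} p)

nonzeroF-unique : ∀ m → Unique (nonzeroF m)
nonzeroF-unique m = Unique.filter⁺ (λ x → ¬? (x ≟F 0F)) (allF-unique m)

allF↭0F∷nonzeroF : ∀ m → allF m ↭ 0F ∷ nonzeroF m
allF↭0F∷nonzeroF m = unique∧set⇒↭ (allF-unique m)
  (All.tabulate (λ x∈ 0≡x → ∈-nonzeroF⁻ x∈ (sym 0≡x)) ∷ nonzeroF-unique m)
  (mk⇔ to (λ _ → ∈-allF _))
  where
  to : ∀ {x} → x ∈ allF m → x ∈ 0F ∷ nonzeroF m
  to {x} _ with x ≟F 0F
  ... | yes x≡0 = here x≡0
  ... | no  x≢0 = there (∈-nonzeroF⁺ x≢0)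

length-nonzeroF : ∀ m → length (nonzeroF m) ≡ 2 ^ m ∸ 1
length-nonzeroF m = cong (_∸ 1) (trans (sym (↭-length (allF↭0F∷nonzeroF m))) (length-allF m))

-- Automorphisms of F₂ᵐ

record Automorphism (m : ℕ) : Set where
  field
    to       : F2^ m → F2^ m
    from     : F2^ m → F2^ m
    to-from  : ∀ x → to (from x) ≡ x
    from-to  : ∀ x → from (to x) ≡ x
    additive : ∀ x y → to (x +F y) ≡ to x +F to y

  to-injective : ∀ {x y} → to x ≡ to y → x ≡ y
  to-injective {x} {y} eq = trans (sym (from-to x)) (trans (cong from eq) (from-to y))

  to-0F : to 0F ≡ 0F
  to-0F = begin
    to 0F                        ≡⟨ +F-identityʳ (to 0F) ⟨
    to 0F +F 0F                  ≡⟨ cong (to 0F +F_) (+F-self (to 0F)) ⟨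
    to 0F +F (to 0F +F to 0F)    ≡⟨ +F-assoc (to 0F) (to 0F) (to 0F) ⟨
    (to 0F +F to 0F) +F to 0F    ≡⟨ cong (_+F to 0F) (additive 0F 0F) ⟨
    to (0F +F 0F) +F to 0F       ≡⟨ cong (λ z → to z +F to 0F) (+F-self 0F) ⟩
    to 0F +F to 0F               ≡⟨ +F-self (to 0F) ⟩
    0F                           ∎
    where open ≡-Reasoning

  to≢0F : ∀ {x} → x ≢ 0F → to x ≢ 0F
  to≢0F x≢0 tx≡0 = x≢0 (to-injective (trans tx≡0 (sym to-0F)))

  sumF-map-to : ∀ xs → sumF (map to xs) ≡ to (sumF xs)
  sumF-map-to []       = sym to-0F
  sumF-map-to (x ∷ xs) = trans (cong (to x +F_) (sumF-map-to xs)) (sym (additive x (sumF xs)))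

  ∈-map-to⇔ : ∀ {x xs} → to x ∈ map to xs ⇔ x ∈ xs
  ∈-map-to⇔ {x} {xs} = mk⇔ from-map (∈-map⁺ to)
    where
    from-map : to x ∈ map to xs → x ∈ xs
    from-map p with ∈-map⁻ to p
    ... | w , w∈ , tx≡tw = subst (_∈ xs) (sym (to-injective tx≡tw)) w∈

  nonzeroF↭map-to : nonzeroF m ↭ map to (nonzeroF m)
  nonzeroF↭map-to =
    unique∧set⇒↭ (nonzeroF-unique m) (Unique.map⁺ to-injective (nonzeroF-unique m)) (mk⇔ into onto)
    where
    into : ∀ {z} → z ∈ nonzeroF m → z ∈ map to (nonzeroF m)
    into {z} z∈ = subst (_∈ map to (nonzeroF m)) (to-from z) (∈-map⁺ to (∈-nonzeroF⁺ from-z≢0))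
      where
      from-z≢0 : from z ≢ 0F
      from-z≢0 fz≡0 = ∈-nonzeroF⁻ z∈ (trans (sym (to-from z)) (trans (cong to fz≡0) to-0F))
    onto : ∀ {z} → z ∈ map to (nonzeroF m) → z ∈ nonzeroF m
    onto p with ∈-map⁻ to p
    ... | w , w∈ , refl = ∈-nonzeroF⁺ (to≢0F (∈-nonzeroF⁻ w∈))

open Automorphism using (to)

idAut : ∀ {m} → Automorphism m
idAut = record
  { to = λ x → x ; from = λ x → x ; to-from = λ _ → refl ; from-to = λ _ → refl ; additive = λ _ _ → refl }

_∘Aut_ : ∀ {m} → Automorphism m → Automorphism m → Automorphism m
τ ∘Aut σ = record
  { to       = T.to ∘ S.to
  ; from     = S.from ∘ T.from
  ; to-from  = λ x → trans (cong T.to (S.to-from (T.from x))) (T.to-from x)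
  ; from-to  = λ x → trans (cong S.from (T.from-to (S.to x))) (S.from-to x)
  ; additive = λ x y → trans (cong T.to (S.additive x y)) (T.additive (S.to x) (S.to y))
  }
  where
  module T = Automorphism τ
  module S = Automorphism σ

liftAut : ∀ {m} → Automorphism m → Automorphism (suc m)
liftAut σ = record
  { to       = λ { (b ∷ x) → b ∷ S.to x }
  ; from     = λ { (b ∷ x) → b ∷ S.from x }
  ; to-from  = λ { (b ∷ x) → cong (b ∷_) (S.to-from x) }
  ; from-to  = λ { (b ∷ x) → cong (b ∷_) (S.from-to x) }
  ; additive = λ { (b ∷ x) (c ∷ y) → cong ((b xor c) ∷_) (S.additive x y) }
  }
  where module S = Automorphism σ

swap₀₁ : ∀ {m} → Automorphism (suc (suc m))
swap₀₁ = record
  { to       = swap-heads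
  ; from     = swap-heads
  ; to-from  = λ { (a ∷ b ∷ x) → refl }
  ; from-to  = λ { (a ∷ b ∷ x) → refl }
  ; additive = λ { (a ∷ b ∷ x) (c ∷ d ∷ y) → refl }
  }
  where
  swap-heads : ∀ {m} → F2^ (suc (suc m)) → F2^ (suc (suc m))
  swap-heads (a ∷ b ∷ x) = b ∷ a ∷ x

transvection₀₁ : ∀ {m} → Automorphism (suc (suc m))
transvection₀₁ = record
  { to       = add₁to₀
  ; from     = add₁to₀
  ; to-from  = λ { (a ∷ b ∷ x) → cong (_∷ b ∷ x) (xor-cancelʳ a b) }
  ; from-to  = λ { (a ∷ b ∷ x) → cong (_∷ b ∷ x) (xor-cancelʳ a b) }
  ; additive = λ { (a ∷ b ∷ x) (c ∷ d ∷ y) → cong (_∷ (b xor d) ∷ (x +F y)) (xor-interchange a c b d) }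
  }
  where
  add₁to₀ : ∀ {m} → F2^ (suc (suc m)) → F2^ (suc (suc m))
  add₁to₀ (a ∷ b ∷ x) = (a xor b) ∷ b ∷ x
  xor-cancelʳ : ∀ a b → (a xor b) xor b ≡ a
  xor-cancelʳ a b = trans (xor-assoc a b b) (trans (cong (a xor_) (xor-same b)) (xor-identityʳ a))

transvection₀₁-if : ∀ {m} → Bool → Automorphism (suc (suc m))
transvection₀₁-if true  = transvection₀₁
transvection₀₁-if false = idAut

e₀ : ∀ {m} → F2^ (suc m)
e₀ = true ∷ 0F

e₁ : ∀ {m} → F2^ (suc (suc m))
e₁ = false ∷ e₀

transvection₀₁-if-clears : ∀ {m} b → to (transvection₀₁-if {m} b) (b ∷ e₀) ≡ e₁
transvection₀₁-if-clears true  = refl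
transvection₀₁-if-clears false = refl

transvection₀₁-if-fixes-e₀ : ∀ {m} b → to (transvection₀₁-if {m} b) e₀ ≡ e₀
transvection₀₁-if-fixes-e₀ true  = refl
transvection₀₁-if-fixes-e₀ false = refl

toE₀ : ∀ m (x : F2^ (suc m)) → x ≢ 0F → Σ (Automorphism (suc m)) λ σ → to σ x ≡ e₀
toE₀ zero    (true ∷ [])  _    = idAut , refl
toE₀ zero    (false ∷ []) x≢0  = ⊥-elim (x≢0 refl)
toE₀ (suc m) (b ∷ x)      bx≢0 with x ≟F 0F
toE₀ (suc m) (true ∷ x)   _    | yes refl = idAut , refl
toE₀ (suc m) (false ∷ x)  bx≢0 | yes refl = ⊥-elim (bx≢0 refl)
... | no x≢0 =
  let σ , σx≡e₀ = toE₀ m x x≢0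
  in swap₀₁ ∘Aut (transvection₀₁-if b ∘Aut liftAut σ) ,
     cong (to swap₀₁)
       (trans (cong (λ v → to (transvection₀₁-if b) (b ∷ v)) σx≡e₀) (transvection₀₁-if-clears b))

fixE₀-toE₁ : ∀ m (y : F2^ (suc (suc m))) → y ≢ 0F → y ≢ e₀ →
             Σ (Automorphism (suc (suc m))) λ σ → to σ e₀ ≡ e₀ × to σ y ≡ e₁
fixE₀-toE₁ m (b ∷ y) by≢0 by≢e₀ with y ≟F 0F
fixE₀-toE₁ m (true ∷ y)  _    by≢e₀ | yes refl = ⊥-elim (by≢e₀ refl)
fixE₀-toE₁ m (false ∷ y) by≢0 _     | yes refl = ⊥-elim (by≢0 refl)
... | no y≢0 =
  let σ , σy≡e₀ = toE₀ m y y≢0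
      open Automorphism σ using (to-0F)
  in transvection₀₁-if b ∘Aut liftAut σ ,
     trans (cong (λ v → to (transvection₀₁-if b) (true ∷ v)) to-0F) (transvection₀₁-if-fixes-e₀ b) ,
     trans (cong (λ v → to (transvection₀₁-if b) (b ∷ v)) σy≡e₀) (transvection₀₁-if-clears b)

toE₀E₁ : ∀ m (x y : F2^ (suc (suc m))) → x ≢ 0F → y ≢ 0F → x ≢ y →
         Σ (Automorphism (suc (suc m))) λ σ → to σ x ≡ e₀ × to σ y ≡ e₁
toE₀E₁ m x y x≢0 y≢0 x≢y =
  let σ₁ , σ₁x≡e₀ = toE₀ (suc m) x x≢0
      open Automorphism σ₁ using (to≢0F; to-injective)
      σ₁y≢e₀ = λ σ₁y≡e₀ → x≢y (to-injective (trans σ₁x≡e₀ (sym σ₁y≡e₀)))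
      σ₂ , σ₂e₀≡e₀ , σ₂σ₁y≡e₁ = fixE₀-toE₁ m (to σ₁ y) (to≢0F y≢0) σ₁y≢e₀
  in σ₂ ∘Aut σ₁ , trans (cong (to σ₂) σ₁x≡e₀) σ₂e₀≡e₀ , σ₂σ₁y≡e₁

-- Blocks through a pair

module _ {m : ℕ} where
  open DecMembership (_≟F_ {m}) using (_∈?_)

  Block : F2^ m → F2^ m → Pred (List (F2^ m)) 0ℓ
  Block x y B = sumF B ≡ 0F × (x ∈ B × y ∈ B)

  Block? : ∀ x y → Decidable (Block x y)
  Block? x y = (λ B → sumF B ≟F 0F) ∩? (λ B → (x ∈? B) ×-dec (y ∈? B))

  Block-resp-↭ : ∀ {x y} → Block x y Respects _↭_
  Block-resp-↭ p (s≡0 , x∈ , y∈) = trans (sym (sumF-resp-↭ p)) s≡0 , ∈-resp-↭ p x∈ , ∈-resp-↭ p y∈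

  Block-map-to : ∀ (σ : Automorphism m) x y → (λ B → Block (to σ x) (to σ y) (map (to σ) B)) ≐ Block x y
  Block-map-to σ x y = transport , untransport
    where
    open Automorphism σ hiding (to)
    transport : ∀ {B} → Block (to σ x) (to σ y) (map (to σ) B) → Block x y B
    transport {B} (s≡0 , x∈ , y∈) =
      to-injective (trans (sym (sumF-map-to B)) (trans s≡0 (sym to-0F))) ,
      Equivalence.to ∈-map-to⇔ x∈ , Equivalence.to ∈-map-to⇔ y∈
    untransport : ∀ {B} → Block x y B → Block (to σ x) (to σ y) (map (to σ) B)
    untransport {B} (s≡0 , x∈ , y∈) =
      trans (sumF-map-to B) (trans (cong (to σ) s≡0) to-0F) ,
      Equivalence.from ∈-map-to⇔ x∈ , Equivalence.from ∈-map-to⇔ y∈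

  pairCount-W : ∀ k x y → pairCount _≟F_ x y (W m k) ≡ combCount (Block? x y) k (nonzeroF m)
  pairCount-W k x y = cong length
    (filter-filter (λ B → (x ∈? B) ×-dec (y ∈? B)) (λ B → sumF B ≟F 0F) (combinations k (nonzeroF m)))

  pairCount-W-invariant : ∀ (σ : Automorphism m) k x y →
                          pairCount _≟F_ (to σ x) (to σ y) (W m k) ≡ pairCount _≟F_ x y (W m k)
  pairCount-W-invariant σ k x y = begin
    pairCount _≟F_ (to σ x) (to σ y) (W m k)         ≡⟨ pairCount-W k (to σ x) (to σ y) ⟩
    combCount Block′? k (nonzeroF m)                   ≡⟨ combCount-resp-↭ Block′? Block-resp-↭ k nonzeroF↭map-to ⟩
    combCount Block′? k (map (to σ) (nonzeroF m))      ≡⟨ combCount-map Block′? (to σ) k (nonzeroF m) ⟩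
    combCount (Block′? ∘ map (to σ)) k (nonzeroF m)    ≡⟨ combCount-≐ _ (Block? x y) (Block-map-to σ x y) k _ ⟩
    combCount (Block? x y) k (nonzeroF m)              ≡⟨ pairCount-W k x y ⟨
    pairCount _≟F_ x y (W m k)                         ∎
    where
    open ≡-Reasoning
    open Automorphism σ using (nonzeroF↭map-to)
    Block′? = Block? (to σ x) (to σ y)

  ∈W⇒∈combinations : ∀ {k B} → B ∈ W m k → B ∈ combinations k (nonzeroF m)
  ∈W⇒∈combinations {k} = proj₁ ∘ ∈-filter⁻ (λ B → sumF B ≟F 0F) {xs = combinations k (nonzeroF m)}

  W-unique : ∀ k → Unique (W m k)
  W-unique k = Unique.filter⁺ (λ B → sumF B ≟F 0F) (unique-combinations k (nonzeroF-unique m))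

W-balanced : ∀ m k (x y : F2^ (suc (suc m))) → x ≢ 0F → y ≢ 0F → x ≢ y →
             pairCount _≟F_ x y (W (suc (suc m)) k) ≡ pairCount _≟F_ e₀ e₁ (W (suc (suc m)) k)
W-balanced m k x y x≢0 y≢0 x≢y =
  let σ , σx≡e₀ , σy≡e₁ = toE₀E₁ m x y x≢0 y≢0 x≢y
  in trans (sym (pairCount-W-invariant σ k x y)) (cong₂ (λ u v → pairCount _≟F_ u v (W _ k)) σx≡e₀ σy≡e₁)

-- Zero-sum sets of nonzero vectors

record NonzeroSubset (m n : ℕ) (c : F2^ m) : Set where
  field
    elems   : List (F2^ m)
    unique  : Unique elems
    nonzero : All (_≢ 0F) elems
    size    : length elems ≡ n
    sum     : sumF elems ≡ c

SubsetsOfAllSizes : ∀ m → F2^ m → ℕ → Set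
SubsetsOfAllSizes m c P = ∀ {n} → 1 ≤ n → n ≤ P → NonzeroSubset m n c

merge : ∀ {m n c} → NonzeroSubset m n c → (T : List (F2^ m)) → Unique T → parity (length T) ≡ false →
        NonzeroSubset (suc m) (n + length T) (false ∷ (c +F sumF T))
merge S T uT even = record
  { elems   = halves elems T
  ; unique  = halves-unique unique uT
  ; nonzero = All.++⁺ (All.map⁺ (All.map (λ x≢0 → x≢0 ∘ ∷-injectiveʳ) nonzero)) (All.map⁺ (All.tabulate λ _ ()))
  ; size    = trans (length-halves elems T) (cong (_+ length T) size)
  ; sum     = trans (sumF-halves elems T) (cong₂ _∷_ even (cong (_+F sumF T) sum))
  }
  where open NonzeroSubset S

mergeInRange : ∀ {m c P n d} → SubsetsOfAllSizes m c P →
               (T : List (F2^ m)) → Unique T → length T ≡ d → parity d ≡ false → d < n → n ≤ P + d →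
               NonzeroSubset (suc m) n (false ∷ (c +F sumF T))
mergeInRange {m} {c} {P} {n} {d} subsets T uT ∣T∣≡d even d<n n≤P+d =
  subst (λ s → NonzeroSubset (suc m) s _) (trans (cong (n ∸ d +_) ∣T∣≡d) (m∸n+n≡m (<⇒≤ d<n)))
    (merge (subsets (m<n⇒0<n∸m d<n) n∸d≤P) T uT (trans (cong parity ∣T∣≡d) even))
  where
  n∸d≤P : n ∸ d ≤ P
  n∸d≤P = subst (n ∸ d ≤_) (m+n∸n≡m P d) (∸-monoˡ-≤ d n≤P+d)

mergeCancelling : ∀ {m c P n d} → SubsetsOfAllSizes m c P → NonzeroSubset m d c →
                  parity d ≡ false → d < n → n ≤ P + d → NonzeroSubset (suc m) n 0F
mergeCancelling {c = c} subsets T even d<n n≤P+d =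
  subst (NonzeroSubset _ _) (cong (false ∷_) (trans (cong (c +F_) sum) (+F-self c)))
    (mergeInRange subsets elems unique size even d<n n≤P+d)
  where open NonzeroSubset T

lastBasis : ∀ m → F2^ m
lastBasis zero          = []
lastBasis (suc zero)    = true ∷ []
lastBasis (suc (suc m)) = false ∷ lastBasis (suc m)

fromList : ∀ {m} (S : List (F2^ m)) {_ : True (unique? _≟F_ S)} {_ : True (All.all? (λ x → ¬? (x ≟F 0F)) S)} →
           NonzeroSubset m (length S) (sumF S)
fromList S {u} {nz} = record { elems = S ; unique = toWitness u ; nonzero = toWitness nz ; size = refl ; sum = refl }

lastBasisSubsets₂ : SubsetsOfAllSizes 2 (lastBasis 2) 2
lastBasisSubsets₂ {1} _ _ = fromList ((false ∷ true ∷ []) ∷ [])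
lastBasisSubsets₂ {2} _ _ = fromList ((true ∷ false ∷ []) ∷ (true ∷ true ∷ []) ∷ [])
lastBasisSubsets₂ {suc (suc (suc _))} _ (s≤s (s≤s ()))

lastBasisSubsets₃ : SubsetsOfAllSizes 3 (lastBasis 3) 6
lastBasisSubsets₃ {1} _ _ = fromList ((false ∷ false ∷ true ∷ []) ∷ [])
lastBasisSubsets₃ {2} _ _ = fromList ((true ∷ false ∷ false ∷ []) ∷ (true ∷ false ∷ true ∷ []) ∷ [])
lastBasisSubsets₃ {3} _ _ =
  fromList ((true ∷ false ∷ false ∷ []) ∷ (false ∷ true ∷ false ∷ []) ∷ (true ∷ true ∷ true ∷ []) ∷ [])
lastBasisSubsets₃ {4} _ _ =
  fromList ((true ∷ false ∷ false ∷ []) ∷ (false ∷ true ∷ false ∷ []) ∷ (true ∷ true ∷ false ∷ [])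
            ∷ (false ∷ false ∷ true ∷ []) ∷ [])
lastBasisSubsets₃ {5} _ _ =
  fromList ((false ∷ false ∷ true ∷ []) ∷ (false ∷ true ∷ false ∷ []) ∷ (false ∷ true ∷ true ∷ [])
            ∷ (true ∷ true ∷ false ∷ []) ∷ (true ∷ true ∷ true ∷ []) ∷ [])
lastBasisSubsets₃ {6} _ _ =
  fromList ((false ∷ true ∷ false ∷ []) ∷ (false ∷ true ∷ true ∷ []) ∷ (true ∷ false ∷ false ∷ [])
            ∷ (true ∷ false ∷ true ∷ []) ∷ (true ∷ true ∷ false ∷ []) ∷ (true ∷ true ∷ true ∷ []) ∷ [])
lastBasisSubsets₃ {suc (suc (suc (suc (suc (suc (suc _))))))} _ (s≤s (s≤s (s≤s (s≤s (s≤s (s≤s ()))))))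

plane : ∀ {m} → List (F2^ (suc (suc m)))
plane = (false ∷ false ∷ 0F) ∷ (true ∷ false ∷ 0F) ∷ (false ∷ true ∷ 0F) ∷ (true ∷ true ∷ 0F) ∷ []

plane-unique : ∀ {m} → Unique (plane {m})
plane-unique = ((λ ()) ∷ (λ ()) ∷ (λ ()) ∷ []) ∷ ((λ ()) ∷ (λ ()) ∷ []) ∷ ((λ ()) ∷ []) ∷ [] ∷ []

sumF-plane : ∀ {m} → sumF (plane {m}) ≡ 0F
sumF-plane = cong (λ v → false ∷ false ∷ v)
  (trans (+F-identityˡ _) (trans (+F-identityˡ _) (trans (+F-identityˡ _) (+F-identityˡ 0F))))

lastBasisSubsets-step : ∀ {m P} → 2 ^ suc (suc m) ≡ 2 + P → 4 ≤ P →
                        SubsetsOfAllSizes (suc (suc m)) (lastBasis (suc (suc m))) P →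
                        SubsetsOfAllSizes (suc (suc (suc m))) (lastBasis (suc (suc (suc m)))) (P + (2 + P))
lastBasisSubsets-step {m} {P} 2^m≡2+P 4≤P subsets {n} 1≤n n≤2P+2 with n ≤? P | n ≤? P + 4
... | yes n≤P | _ =
  subst (NonzeroSubset _ n) (cong (false ∷_) (+F-identityʳ c))
    (mergeInRange subsets [] [] refl refl 1≤n (subst (n ≤_) (sym (+-identityʳ P)) n≤P))
  where c = lastBasis (suc (suc m))
... | no n≰P | yes n≤P+4 =
  subst (NonzeroSubset _ n) (cong (false ∷_) (trans (cong (c +F_) sumF-plane) (+F-identityʳ c)))
    (mergeInRange subsets plane plane-unique refl refl (≤-<-trans 4≤P (≰⇒> n≰P)) n≤P+4)
  where c = lastBasis (suc (suc m))
... | no _ | no n≰P+4 =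
  subst (NonzeroSubset _ n) (cong (false ∷_) (trans (cong (c +F_) (sumF-allF m)) (+F-identityʳ c)))
    (mergeInRange subsets (allF (suc (suc m))) (allF-unique (suc (suc m))) ∣allF∣≡2+P even
      (≤-<-trans 2+P≤P+4 (≰⇒> n≰P+4)) n≤2P+2)
  where
  c = lastBasis (suc (suc m))
  ∣allF∣≡2+P : length (allF (suc (suc m))) ≡ 2 + P
  ∣allF∣≡2+P = trans (length-allF (suc (suc m))) 2^m≡2+P
  even : parity (2 + P) ≡ false
  even = trans (cong parity (sym 2^m≡2+P)) (parity-2^suc (suc m))
  2+P≤P+4 : 2 + P ≤ P + 4
  2+P≤P+4 = ≤-trans (≤-reflexive (+-comm 2 P)) (+-monoʳ-≤ P (s≤s (s≤s z≤n)))

zeroSumSubsets-step : ∀ {m P} → 2 ^ suc m ≡ 2 + P → 2 ≤ P →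
                      SubsetsOfAllSizes (suc m) (lastBasis (suc m)) P →
                      ∀ {n} → 3 ≤ n → n ≤ P + P → NonzeroSubset (suc (suc m)) n 0F
zeroSumSubsets-step {m} {P} 2^m≡2+P 2≤P subsets {n} 3≤n n≤2P with n ≤? P + 2
... | yes n≤P+2 = mergeCancelling subsets (subsets (s≤s z≤n) 2≤P) refl 3≤n n≤P+2
... | no n≰P+2  =
  mergeCancelling subsets (subsets (≤-trans (s≤s z≤n) 2≤P) ≤-refl) evenP
    (≤-<-trans (m≤m+n P 2) (≰⇒> n≰P+2)) n≤2P
  where
  evenP : parity P ≡ false
  evenP = trans (sym (not-involutive (parity P))) (trans (cong parity (sym 2^m≡2+P)) (parity-2^suc m))

2^suc≡2+[2^suc∸2] : ∀ m → 2 ^ suc m ≡ 2 + (2 ^ suc m ∸ 2)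
2^suc≡2+[2^suc∸2] m = sym (m+[n∸m]≡n (^-monoʳ-≤ 2 (s≤s (z≤n {m}))))

doubled∸2 : ∀ {N P} → N ≡ 2 + P → N + (N + 0) ∸ 2 ≡ P + (2 + P)
doubled∸2 {P = P} refl = cong (P +_) (+-identityʳ (2 + P))

doubled∸4 : ∀ {N P} → N ≡ 2 + P → N + (N + 0) ∸ 4 ≡ P + P
doubled∸4 {P = P} refl =
  cong (_∸ 2) (trans (cong (P +_) (+-identityʳ (2 + P))) (trans (+-suc P (suc P)) (cong suc (+-suc P P))))

lastBasisSubsets : ∀ m → 2 ≤ m → SubsetsOfAllSizes m (lastBasis m) (2 ^ m ∸ 2)
lastBasisSubsets 1 (s≤s ())
lastBasisSubsets 2 _ = lastBasisSubsets₂
lastBasisSubsets 3 _ = lastBasisSubsets₃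
lastBasisSubsets (suc (suc (suc (suc m)))) _ {n} 1≤n n≤ =
  lastBasisSubsets-step (2^suc≡2+[2^suc∸2] (suc (suc m))) 4≤P
    (lastBasisSubsets (suc (suc (suc m))) (s≤s (s≤s z≤n))) 1≤n
    (subst (n ≤_) (doubled∸2 (2^suc≡2+[2^suc∸2] (suc (suc m)))) n≤)
  where
  4≤P : 4 ≤ 2 ^ suc (suc (suc m)) ∸ 2
  4≤P = ≤-trans (m≤n+m 4 2) (∸-monoˡ-≤ 2 (^-monoʳ-≤ 2 {3} {suc (suc (suc m))} (s≤s (s≤s (s≤s z≤n)))))

zeroSumSubsets : ∀ m {n} → 3 ≤ n → n ≤ 2 ^ (3 + m) ∸ 4 → NonzeroSubset (3 + m) n 0F
zeroSumSubsets m {n} 3≤n n≤ =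
  zeroSumSubsets-step (2^suc≡2+[2^suc∸2] (suc m)) 2≤P (lastBasisSubsets (suc (suc m)) (s≤s (s≤s z≤n))) 3≤n
    (subst (n ≤_) (doubled∸4 (2^suc≡2+[2^suc∸2] (suc m))) n≤)
  where
  2≤P : 2 ≤ 2 ^ suc (suc m) ∸ 2
  2≤P = ∸-monoˡ-≤ 2 (^-monoʳ-≤ 2 {2} {suc (suc m)} (s≤s (s≤s z≤n)))

zeroSum⇒pairCount-positive : ∀ {m k} → NonzeroSubset m k 0F → 2 ≤ k →
  Σ (F2^ m) λ x → Σ (F2^ m) λ y → x ≢ 0F × y ≢ 0F × x ≢ y × 1 ≤ pairCount _≟F_ x y (W m k)
zeroSum⇒pairCount-positive {m}
  record { elems = x ∷ y ∷ xs ; unique = u@((x≢y ∷ _) ∷ _) ; nonzero = nz@(x≢0 ∷ y≢0 ∷ _)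
         ; size = refl ; sum = s≡0 } _ =
  x , y , x≢0 , y≢0 , x≢y ,
  subst (1 ≤_) (sym (pairCount-W (length (x ∷ y ∷ xs)) x y))
    (combCount-positive _≟F_ (Block? x y) Block-resp-↭ (nonzeroF-unique m) u (All.map ∈-nonzeroF⁺ nz)
      (s≡0 , here refl , there (here refl)))
zeroSum⇒pairCount-positive record { elems = []     ; size = refl } ()
zeroSum⇒pairCount-positive record { elems = _ ∷ [] ; size = refl } (s≤s ())

≤∸4⇒<∸1 : ∀ {k N} → 4 ≤ N → k ≤ N ∸ 4 → k < N ∸ 1
≤∸4⇒<∸1 (s≤s (s≤s (s≤s (s≤s _)))) k≤N∸4 = s≤s (≤-trans k≤N∸4 (m≤n+m _ 2))

theorem2p7 : (m : ℕ) → 3 ≤ m → (k : ℕ) → 3 ≤ k → k ≤ 2 ^ m ∸ 4 →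
    Σ ℕ (λ λk → (1 ≤ λk) ×
      IsBIBD _≟F_ (nonzeroF m) (W m k) (2 ^ m ∸ 1) k λk)
theorem2p7 (suc (suc zero)) (s≤s (s≤s ()))
theorem2p7 (suc (suc (suc m))) _ k 3≤k k≤ =
  pairCount _≟F_ e₀ e₁ (W M k) , positive , record
    { k≥2            = ≤-trans (s≤s (s≤s z≤n)) 3≤k
    ; k<v            = ≤∸4⇒<∸1 (^-monoʳ-≤ 2 {2} {M} (s≤s (s≤s z≤n))) k≤
    ; pointsSize     = length-nonzeroF M
    ; pointsUnique   = nonzeroF-unique M
    ; blocksSize     = All.tabulate (∈-combinations⇒length k _ ∘ ∈W⇒∈combinations {k = k})
    ; blocksUnique   = All.tabulate (∈-combinations⇒Unique k (nonzeroF-unique M) ∘ ∈W⇒∈combinations {k = k})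
    ; blocksInX      = All.tabulate (∈-combinations⇒⊆ k _ ∘ ∈W⇒∈combinations {k = k})
    ; blocksDistinct = W-unique k
    ; balanced       = λ x y x∈ y∈ x≢y → W-balanced (suc m) k x y (∈-nonzeroF⁻ x∈) (∈-nonzeroF⁻ y∈) x≢y
    }
  where
  M = 3 + m
  positive : 1 ≤ pairCount _≟F_ e₀ e₁ (W M k)
  positive =
    let x , y , x≢0 , y≢0 , x≢y , 1≤xy =
          zeroSum⇒pairCount-positive (zeroSumSubsets m 3≤k k≤) (≤-trans (s≤s (s≤s z≤n)) 3≤k)
    in subst (1 ≤_) (W-balanced (suc m) k x y x≢0 y≢0 x≢y) 1≤xy
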